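{- (i) For every graph property $\mathcal{C}$, $\mathcal{C}\leq_{s.d.p.}\mathbf{P}^{ind}_{\mathcal{C}}$. (ii) For every graph property $\mathcal{D}$ closed under adding isolated vertices, $\mathcal{D}\leq_{s.d.p.}\mathbf{P}^{span}_{\mathcal{D}}$.
   Context: All graphs are finite without multiple edges. A graph property is an isomorphism-closed class of graphs, regarded as the 0/1-valued invariant (indicator of membership). $\mathbf{P}^{ind}_{\mathcal{C}}(G;X)=\sum_{A\subseteq V(G):G[A]\in\mathcal{C}}X^{|A|}$ ($G[A]$ the induced subgraph) and $\mathbf{P}^{span}_{\mathcal{D}}(G;X)=\sum_{B\subseteq E(G):(V(G),B)\in\mathcal{D}}X^{|B|}$. Two graphs are similar if they have the same numbers of vertices, edges and connected components. For graph invariants $\mathbf{P},\mathbf{Q}$, $\mathbf{P}\leq_{s.d.p.}\mathbf{Q}$ means: for all similar graphs $G_1,G_2$, $\mathbf{Q}(G_1)=\mathbf{Q}(G_2)$ implies $\mathbf{P}(G_1)=\mathbf{P}(G_2)$. -}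

module Defs where

open import Data.Bool using (Bool; true; false; _∧_; _∨_; not; if_then_else_)
open import Data.Bool.Properties using (∨-comm)
open import Data.Nat using (ℕ; zero; suc; _≤ᵇ_; _<ᵇ_; _≡ᵇ_)
open import Data.Fin using (Fin; toℕ) renaming (zero to fzero; suc to fsuc)
import Data.Fin as Fin
open import Data.List using (List; []; _∷_; _++_; map; length; lookup; allFin; concatMap; filter)
open import Data.Bool.ListAction using (any)
open import Data.Product using (_×_; _,_; proj₁; proj₂)
open import Relation.Nullary.Decidable using (⌊_⌋)
open import Relation.Binary.PropositionalEquality using (_≡_; refl; cong)
open import Function.Bundles using (_↔_; Inverse)
open import Level using (0ℓ)

-- Finite graphs without multiple edges (loops are permitted).
-- Vertices are Fin n; adjacency is a symmetric Boolean matrix.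

record Graph : Set where
  field
    n   : ℕ
    adj : Fin n → Fin n → Bool
    adj-sym : ∀ i j → adj i j ≡ adj j i
open Graph public

record Iso (G H : Graph) : Set where
  field
    bij : Fin (n G) ↔ Fin (n H)
    pres : ∀ i j → adj H (Inverse.to bij i) (Inverse.to bij j) ≡ adj G i j

record GraphProperty : Set where
  field
    mem : Graph → Bool
    iso-closed : ∀ G H → Iso G H → mem G ≡ mem H
open GraphProperty public

_==_ : ∀ {m} → Fin m → Fin m → Bool
i == j = ⌊ i Fin.≟ j ⌋

countTrue : List Bool → ℕ
countTrue [] = 0
countTrue (true ∷ bs) = suc (countTrue bs)
countTrue (false ∷ bs) = countTrue bs

-- all sublists (= all subsets of the positions) of a list
sublists : {A : Set} → List A → List (List A)
sublists [] = [] ∷ []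
sublists (x ∷ xs) = map (x ∷_) (sublists xs) ++ sublists xs

-- Induced subgraph G[A], A a duplicate-free list of vertices (a subset of V(G))

induced : (G : Graph) → List (Fin (n G)) → Graph
induced G A = record
  { n = length A
  ; adj = λ i j → adj G (lookup A i) (lookup A j)
  ; adj-sym = λ i j → Graph.adj-sym G (lookup A i) (lookup A j) }

edges : (G : Graph) → List (Fin (n G) × Fin (n G))
edges G = concatMap (λ i → concatMap (λ j →
            if (toℕ i ≤ᵇ toℕ j) ∧ adj G i j then (i , j) ∷ [] else [])
            (allFin (n G))) (allFin (n G))

numEdges : Graph → ℕ
numEdges G = length (edges G)

matches : ∀ {m} → Fin m × Fin m → Fin m → Fin m → Bool
matches (a , b) i j = ((a == i) ∧ (b == j)) ∨ ((a == j) ∧ (b == i))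

matches-sym : ∀ {m} (e : Fin m × Fin m) i j → matches e i j ≡ matches e j i
matches-sym (a , b) i j = ∨-comm ((a == i) ∧ (b == j)) ((a == j) ∧ (b == i))

any-cong : ∀ {A : Set} (f g : A → Bool) → (∀ x → f x ≡ g x) → ∀ xs → any f xs ≡ any g xs
any-cong f g h [] = refl
any-cong f g h (x ∷ xs) rewrite h x | any-cong f g h xs = refl

spanning : (G : Graph) → List (Fin (n G) × Fin (n G)) → Graph
spanning G B = record
  { n = n G
  ; adj = λ i j → any (λ e → matches e i j) B
  ; adj-sym = λ i j → any-cong (λ e → matches e i j) (λ e → matches e j i)
                    (λ e → matches-sym e i j) B }

reach : (G : Graph) → ℕ → Fin (n G) → Fin (n G) → Bool
reach G zero i j = i == j
reach G (suc k) i j = reach G k i j ∨ any (λ l → reach G k i l ∧ adj G l j) (allFin (n G))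

connected : (G : Graph) → Fin (n G) → Fin (n G) → Bool
connected G = reach G (n G)

-- number of connected components = number of vertices that are the
-- least-indexed vertex of their component
numComponents : Graph → ℕ
numComponents G = countTrue (map (λ i →
  not (any (λ j → (toℕ j <ᵇ toℕ i) ∧ connected G j i) (allFin (n G))))
  (allFin (n G)))

Similar : Graph → Graph → Set
Similar G₁ G₂ = (n G₁ ≡ n G₂) × (numEdges G₁ ≡ numEdges G₂) × (numComponents G₁ ≡ numComponents G₂)

-- Polynomials in X with natural coefficients, as coefficient sequences;
-- equality of polynomials is coefficientwise.

Poly : Set
Poly = ℕ → ℕ

_≈P_ : Poly → Poly → Set
p ≈P q = ∀ k → p k ≡ q k

-- P^ind_C(G; X) = Σ_{A ⊆ V(G), G[A] ∈ C} X^|A|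
Pind : GraphProperty → Graph → Poly
Pind C G k = countTrue (map (λ A → (length A ≡ᵇ k) ∧ mem C (induced G A))
                            (sublists (allFin (n G))))

-- P^span_D(G; X) = Σ_{B ⊆ E(G), (V(G),B) ∈ D} X^|B|
Pspan : GraphProperty → Graph → Poly
Pspan D G k = countTrue (map (λ B → (length B ≡ᵇ k) ∧ mem D (spanning G B))
                             (sublists (edges G)))

SDP≤ : {A B : Set} → (A → A → Set) → (B → B → Set) → (Graph → A) → (Graph → B) → Set
SDP≤ _≈A_ _≈B_ P Q = ∀ G₁ G₂ → Similar G₁ G₂ → Q G₁ ≈B Q G₂ → P G₁ ≈A P G₂

addIsolated : Graph → Graph
addIsolated G = record { n = suc (n G) ; adj = a ; adj-sym = s }
  where
  a : Fin (suc (n G)) → Fin (suc (n G)) → Bool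
  a fzero _ = false
  a (fsuc i) fzero = false
  a (fsuc i) (fsuc j) = adj G i j
  s : ∀ i j → a i j ≡ a j i
  s fzero fzero = refl
  s fzero (fsuc j) = refl
  s (fsuc i) fzero = refl
  s (fsuc i) (fsuc j) = Graph.adj-sym G i j

ClosedUnderIsolated : GraphProperty → Set
ClosedUnderIsolated D = ∀ G → mem D G ≡ true → mem D (addIsolated G) ≡ true

-- The coefficient of X^|V(G)| in P^ind_C(G) counts the subsets A ⊆ V(G) of full size, i.e.
-- only A = V(G); it is 1 if G[V(G)] ≅ G lies in C and 0 otherwise. Similar graphs have the
-- same number of vertices, so equal polynomials force equal membership in C. The same
-- argument with the coefficient of X^|E(G)| in P^span_D(G) and B = E(G) gives (ii).
module Submission where

open import Defs
open import Data.Bool using (Bool; true; false; _∧_; if_then_else_; T)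
open import Data.Bool.Properties using (T-∨; T-∧; T-≡; ⇔→≡)
open import Data.Nat using (ℕ; suc; _+_; _<_; s≤s; _≡ᵇ_; _≤ᵇ_)
open import Data.Nat.Properties using (≤-total; ≤⇒≤ᵇ; n<1+n; m<n⇒m<1+n; +-identityʳ)
open import Data.Fin using (Fin; toℕ; cast)
import Data.Fin as Fin
open import Data.Fin.Properties using (cast-involutive)
open import Data.List using (List; []; _∷_; _++_; map; length; lookup; allFin; tabulate)
open import Data.List.Properties using (map-++; map-∘; length-tabulate; lookup-tabulate)
open import Data.List.Membership.Propositional using (_∈_; find)
open import Data.List.Membership.Propositional.Properties using (∈-concatMap⁺; ∈-concatMap⁻; ∈-allFin)
open import Data.List.Relation.Unary.Any using (here; satisfied)
open import Data.List.Relation.Unary.Any.Properties using (any⁺; any⁻)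
import Data.List.Relation.Unary.Any as Any
open import Data.Bool.ListAction using (any)
open import Data.Product using (_×_; _,_; proj₁; proj₂)
open import Data.Sum using (_⊎_; inj₁; inj₂)
open import Function using (_∘_; id; _⇔_; Equivalence; mk⇔)
open import Function.Bundles using (_↔_; mk↔ₛ′)
open import Function.Construct.Identity using (↔-id)
import Function.Properties.Equivalence as ⇔
open import Relation.Nullary.Decidable using (toWitness; fromWitness)
open import Relation.Binary.PropositionalEquality using (_≡_; refl; sym; trans; cong; cong₂; subst)
open Relation.Binary.PropositionalEquality.≡-Reasoning

indicator : Bool → ℕ
indicator b = if b then 1 else 0

indicator-injective : ∀ {a b} → indicator a ≡ indicator b → a ≡ b
indicator-injective {true}  {true}  _ = refl
indicator-injective {false} {false} _ = refl
indicator-injective {true}  {false} ()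
indicator-injective {false} {true}  ()

countTrue-++ : (bs cs : List Bool) → countTrue (bs ++ cs) ≡ countTrue bs + countTrue cs
countTrue-++ []          cs = refl
countTrue-++ (true ∷ bs) cs = cong suc (countTrue-++ bs cs)
countTrue-++ (false ∷ bs) cs = countTrue-++ bs cs

-- Σ_{B ⊆ xs, P B} X^|B|; Pind C G and Pspan D G are instances of it definitionally.
sublistPoly : {A : Set} → (List A → Bool) → List A → Poly
sublistPoly P xs k = countTrue (map (λ B → (length B ≡ᵇ k) ∧ P B) (sublists xs))

sublistPoly-∷ : {A : Set} (P : List A → Bool) (x : A) (xs : List A) (k : ℕ) →
  sublistPoly P (x ∷ xs) (suc k) ≡ sublistPoly (P ∘ (x ∷_)) xs k + sublistPoly P xs (suc k)
sublistPoly-∷ P x xs k = begin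
  countTrue (map f (map (x ∷_) (sublists xs) ++ sublists xs))
    ≡⟨ cong countTrue (map-++ f (map (x ∷_) (sublists xs)) (sublists xs)) ⟩
  countTrue (map f (map (x ∷_) (sublists xs)) ++ map f (sublists xs))
    ≡⟨ countTrue-++ (map f (map (x ∷_) (sublists xs))) (map f (sublists xs)) ⟩
  countTrue (map f (map (x ∷_) (sublists xs))) + sublistPoly P xs (suc k)
    ≡⟨ cong (λ bs → countTrue bs + sublistPoly P xs (suc k)) (sym (map-∘ (sublists xs))) ⟩
  sublistPoly (P ∘ (x ∷_)) xs k + sublistPoly P xs (suc k)
    ∎
  where
  f : List _ → Bool
  f B = (length B ≡ᵇ suc k) ∧ P B

sublistPoly-beyond : {A : Set} (P : List A → Bool) (xs : List A) {k : ℕ} →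
  length xs < k → sublistPoly P xs k ≡ 0
sublistPoly-beyond P []       {suc k} _ = refl
sublistPoly-beyond P (x ∷ xs) {suc k} (s≤s lt) = begin
  sublistPoly P (x ∷ xs) (suc k)
    ≡⟨ sublistPoly-∷ P x xs k ⟩
  sublistPoly (P ∘ (x ∷_)) xs k + sublistPoly P xs (suc k)
    ≡⟨ cong₂ _+_ (sublistPoly-beyond (P ∘ (x ∷_)) xs lt)
                 (sublistPoly-beyond P xs (m<n⇒m<1+n lt)) ⟩
  0
    ∎

sublistPoly-top : {A : Set} (P : List A → Bool) (xs : List A) →
  sublistPoly P xs (length xs) ≡ indicator (P xs)
sublistPoly-top P [] with P []
... | true  = refl
... | false = refl
sublistPoly-top P (x ∷ xs) = begin
  sublistPoly P (x ∷ xs) (suc (length xs))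
    ≡⟨ sublistPoly-∷ P x xs (length xs) ⟩
  sublistPoly (P ∘ (x ∷_)) xs (length xs) + sublistPoly P xs (suc (length xs))
    ≡⟨ cong₂ _+_ (sublistPoly-top (P ∘ (x ∷_)) xs) (sublistPoly-beyond P xs (n<1+n (length xs))) ⟩
  indicator (P (x ∷ xs)) + 0
    ≡⟨ +-identityʳ (indicator (P (x ∷ xs))) ⟩
  indicator (P (x ∷ xs))
    ∎

sublistPoly-top-injective : {A B : Set} (P : List A → Bool) (Q : List B → Bool)
  (xs : List A) (ys : List B) → length xs ≡ length ys →
  sublistPoly P xs ≈P sublistPoly Q ys → P xs ≡ Q ys
sublistPoly-top-injective P Q xs ys |xs|≡|ys| P≈Q = indicator-injective (begin
  indicator (P xs)                 ≡⟨ sym (sublistPoly-top P xs) ⟩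
  sublistPoly P xs (length xs)     ≡⟨ P≈Q (length xs) ⟩
  sublistPoly Q ys (length xs)     ≡⟨ cong (sublistPoly Q ys) |xs|≡|ys| ⟩
  sublistPoly Q ys (length ys)     ≡⟨ sublistPoly-top Q ys ⟩
  indicator (Q ys)                 ∎)

lookup-tabulate-cast : {A : Set} {m : ℕ} (f : Fin m → A) (i : Fin (length (tabulate f))) →
  lookup (tabulate f) i ≡ f (cast (length-tabulate f) i)
lookup-tabulate-cast {m = suc m} f Fin.zero    = refl
lookup-tabulate-cast {m = suc m} f (Fin.suc i) = lookup-tabulate-cast (f ∘ Fin.suc) i

lookup-allFin-↔ : (m : ℕ) → Fin (length (allFin m)) ↔ Fin m
lookup-allFin-↔ m = mk↔ₛ′ (lookup (allFin m)) (cast (sym |allFin|≡m))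
  (lookup-tabulate id)
  (λ i → trans (cong (cast (sym |allFin|≡m)) (lookup-tabulate-cast id i))
               (cast-involutive (sym |allFin|≡m) |allFin|≡m i))
  where
  |allFin|≡m : length (allFin m) ≡ m
  |allFin|≡m = length-tabulate id

induced-allFin-iso : (G : Graph) → Iso (induced G (allFin (n G))) G
induced-allFin-iso G = record { bij = lookup-allFin-↔ (n G) ; pres = λ i j → refl }

∈-if-singleton : {A : Set} {c : Bool} {a e : A} →
  e ∈ (if c then a ∷ [] else []) → T c × e ≡ a
∈-if-singleton {c = true} (here e≡a) = _ , e≡a

module _ (G : Graph) where

  ∈-edges⁻ : ∀ {e} → e ∈ edges G → T (adj G (proj₁ e) (proj₂ e))
  ∈-edges⁻ e∈E with satisfied (∈-concatMap⁻ _ {xs = allFin (n G)} e∈E)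
  ... | i , e∈Eᵢ with satisfied (∈-concatMap⁻ _ {xs = allFin (n G)} e∈Eᵢ)
  ... | j , e∈Eᵢⱼ with ∈-if-singleton e∈Eᵢⱼ
  ... | i≤j∧ij , refl = proj₂ (Equivalence.to T-∧ i≤j∧ij)

  ∈-edges⁺ : ∀ {i j} → T (toℕ i ≤ᵇ toℕ j) → T (adj G i j) → (i , j) ∈ edges G
  ∈-edges⁺ {i} {j} i≤j ij =
    ∈-concatMap⁺ _ (Any.map (λ { refl →
      ∈-concatMap⁺ _ (Any.map (λ { refl → selected }) (∈-allFin j)) }) (∈-allFin i))
    where
    selected : (i , j) ∈ (if (toℕ i ≤ᵇ toℕ j) ∧ adj G i j then (i , j) ∷ [] else [])
    selected with (toℕ i ≤ᵇ toℕ j) ∧ adj G i j | Equivalence.from T-∧ (i≤j , ij)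
    ... | true | _ = here refl

  matches⁻ : {a b i j : Fin (n G)} → T (matches (a , b) i j) → (a ≡ i × b ≡ j) ⊎ (a ≡ j × b ≡ i)
  matches⁻ {a} {b} {i} {j} m with Equivalence.to (T-∨ {(a == i) ∧ (b == j)}) m
  ... | inj₁ ab≡ij = let (a≡i , b≡j) = Equivalence.to (T-∧ {a == i}) ab≡ij
                     in inj₁ (toWitness a≡i , toWitness b≡j)
  ... | inj₂ ab≡ji = let (a≡j , b≡i) = Equivalence.to (T-∧ {a == j}) ab≡ji
                     in inj₂ (toWitness a≡j , toWitness b≡i)

  matches⁺ : {a b i j : Fin (n G)} → (a ≡ i × b ≡ j) ⊎ (a ≡ j × b ≡ i) → T (matches (a , b) i j)
  matches⁺ {a} {b} (inj₁ (refl , refl)) =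
    Equivalence.from (T-∨ {(a == a) ∧ (b == b)}) (inj₁ (Equivalence.from (T-∧ {a == a})
      (fromWitness {a? = a Fin.≟ a} refl , fromWitness {a? = b Fin.≟ b} refl)))
  matches⁺ {a} {b} (inj₂ (refl , refl)) =
    Equivalence.from (T-∨ {(a == b) ∧ (b == a)}) (inj₂ (Equivalence.from (T-∧ {a == a})
      (fromWitness {a? = a Fin.≟ a} refl , fromWitness {a? = b Fin.≟ b} refl)))

  spanning-edges-adj : (i j : Fin (n G)) → T (adj G i j) ⇔ T (any (λ e → matches e i j) (edges G))
  spanning-edges-adj i j = mk⇔ to from
    where
    to : T (adj G i j) → T (any (λ e → matches e i j) (edges G))
    to ij with ≤-total (toℕ i) (toℕ j)
    ... | inj₁ i≤j = any⁺ _ (Any.map (λ { refl → matches⁺ {i} {j} (inj₁ (refl , refl)) })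
                                    (∈-edges⁺ (≤⇒≤ᵇ i≤j) ij))
    ... | inj₂ j≤i = any⁺ _ (Any.map (λ { refl → matches⁺ {j} {i} (inj₂ (refl , refl)) })
                                    (∈-edges⁺ (≤⇒≤ᵇ j≤i) (subst T (Graph.adj-sym G i j) ij)))
    from : T (any (λ e → matches e i j) (edges G)) → T (adj G i j)
    from m with find (any⁻ (λ e → matches e i j) (edges G) m)
    ... | (a , b) , e∈E , ab~ij with matches⁻ {a} {b} {i} {j} ab~ij
    ... | inj₁ (refl , refl) = ∈-edges⁻ e∈E
    ... | inj₂ (refl , refl) rewrite Graph.adj-sym G i j = ∈-edges⁻ e∈E

  spanning-edges-iso : Iso (spanning G (edges G)) G
  spanning-edges-iso = record
    { bij  = ↔-id _
    ; pres = λ i j → ⇔→≡ {z = true} (⇔.trans (⇔.sym T-≡) (⇔.trans (spanning-edges-adj i j) T-≡)) }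

corollary1 : ((C : GraphProperty) → SDP≤ {Bool} _≡_ _≈P_ (mem C) (Pind C))
    × ((D : GraphProperty) → ClosedUnderIsolated D → SDP≤ {Bool} _≡_ _≈P_ (mem D) (Pspan D))
corollary1 = induced-part , spanning-part
  where
  induced-part : (C : GraphProperty) → SDP≤ {Bool} _≡_ _≈P_ (mem C) (Pind C)
  induced-part C G₁ G₂ (n₁≡n₂ , _ , _) Pind≈ = begin
    mem C G₁                              ≡⟨ sym (iso-closed C _ _ (induced-allFin-iso G₁)) ⟩
    mem C (induced G₁ (allFin (n G₁)))    ≡⟨ sublistPoly-top-injective _ _ (allFin (n G₁)) (allFin (n G₂))
                                                                 |V₁|≡|V₂| Pind≈ ⟩
    mem C (induced G₂ (allFin (n G₂)))    ≡⟨ iso-closed C _ _ (induced-allFin-iso G₂) ⟩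
    mem C G₂                              ∎
    where
    |V₁|≡|V₂| : length (allFin (n G₁)) ≡ length (allFin (n G₂))
    |V₁|≡|V₂| = trans (length-tabulate id) (trans n₁≡n₂ (sym (length-tabulate id)))

  spanning-part : (D : GraphProperty) → ClosedUnderIsolated D → SDP≤ {Bool} _≡_ _≈P_ (mem D) (Pspan D)
  spanning-part D _ G₁ G₂ (_ , |E₁|≡|E₂| , _) Pspan≈ = begin
    mem D G₁                              ≡⟨ sym (iso-closed D _ _ (spanning-edges-iso G₁)) ⟩
    mem D (spanning G₁ (edges G₁))        ≡⟨ sublistPoly-top-injective _ _ (edges G₁) (edges G₂)
                                                                 |E₁|≡|E₂| Pspan≈ ⟩
    mem D (spanning G₂ (edges G₂))        ≡⟨ iso-closed D _ _ (spanning-edges-iso G₂) ⟩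
    mem D G₂                              ∎
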